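{- Let $n,d>1$ be integers. Set $X=\{jd : 0\le j\le n\}$, $m=(4n+1)d+1$, $Y=m-X=\{m-x: x\in X\}$, $Z=\{z\in\mathbb{Z} : 2nd<z\le (2n+1)d\}$, $B=X\sqcup Y\sqcup Z$, $a=2nd$, and $A=B\sqcup\{a\}$. Then $A$ is a normalised set with $|A+A|=|A-A|+1$ (in particular $|A+A|>|A-A|$).
   Context: For $A\subseteq\mathbb{Z}$, $A+A=\{a_1+a_2 : a_1,a_2\in A\}$ and $A-A=\{a_1-a_2 : a_1,a_2\in A\}$. A finite set $A\subseteq\mathbb{Z}$ is normalised if its smallest element is $0$ and the greatest common divisor of its elements is $1$. -}

module Defs where

open import Data.Nat using (ℕ; suc; _*_; _+_)
open import Data.Integer as ℤ using (ℤ; +_; _≤_; _-_)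
open import Data.Integer.GCD using (gcd)
open import Data.List using (List; []; _∷_; map; upTo; _++_; length; deduplicate; cartesianProductWith; foldr)
open import Data.List.Membership.Propositional using (_∈_)
open import Data.List.Relation.Unary.All using (All)
open import Data.Product using (_×_)
open import Relation.Binary.PropositionalEquality using (_≡_)

-- Finite sets of integers are represented by lists (possibly with repetitions);
-- the cardinality of the underlying set is the length after removing duplicates.
card : List ℤ → ℕ
card xs = length (deduplicate ℤ._≟_ xs)

sumset : List ℤ → List ℤ
sumset A = cartesianProductWith ℤ._+_ A A

diffset : List ℤ → List ℤ
diffset A = cartesianProductWith ℤ._-_ A A

gcdList : List ℤ → ℤ
gcdList = foldr gcd (+ 0)

Normalised : List ℤ → Set
Normalised A = ((+ 0) ∈ A × All (λ x → + 0 ≤ x) A) × gcdList A ≡ + 1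

X : ℕ → ℕ → List ℤ
X n d = map (λ j → + (j * d)) (upTo (suc n))

mval : ℕ → ℕ → ℤ
mval n d = + ((4 * n + 1) * d + 1)

Y : ℕ → ℕ → List ℤ
Y n d = map (λ x → mval n d - x) (X n d)

Z : ℕ → ℕ → List ℤ
Z n d = map (λ k → + (2 * n * d + suc k)) (upTo d)

B : ℕ → ℕ → List ℤ
B n d = X n d ++ Y n d ++ Z n d

aval : ℕ → ℕ → ℤ
aval n d = + (2 * n * d)

Aset : ℕ → ℕ → List ℤ
Aset n d = B n d ++ (aval n d ∷ [])

module Submission where

-- Write N = nd, C = 3N + d + 1 and m = C + N, so that A = X ∪ [2N, 2N + d] ∪ Y with
-- X = {0, d, …, N} and Y = m − X = C + X.  Reflection in m maps A onto the set A₁ whose middle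
-- interval is shifted to [2N + 1, 2N + d + 1], so A − A = (A + A₁) − m, and both |A + A| and
-- |A − A| are cardinalities of sumsets A + Aᵥ (v = 0, 1), where A₀ = A.  Such a sumset is the
-- disjoint union of seven explicit arithmetic progressions; the only one depending on v is the
-- interval [4N + v, 4N + 2d] coming from the middle, which has one element fewer for v = 1.
-- Finally gcd A = 1 because both a = 2N and 2N + 1 lie in A.

open import Defs
open import Data.Nat using (ℕ; zero; suc; _+_; _*_; _∸_; _≤_; _<_; z≤n; s≤s; z<s; NonZero; >-nonZero; _≤?_)
open import Data.Nat.Properties
open import Data.Nat.Tactic.RingSolver using (solve; solve-∀)
open import Data.Nat.ListAction using (sum)
import Data.Nat.Divisibility as ℕ∣
open import Data.Integer using (-_; _-_)
import Data.Integer as ℤ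
import Data.Integer.Properties as ℤ
import Data.Integer.Tactic.RingSolver as ℤSolver
import Data.Integer.Divisibility as ℤ∣
open import Data.Integer.GCD using (gcd[i,j]∣i; gcd[i,j]∣j)
open import Data.Product using (_×_; ∃; ∃₂; _,_)
open import Data.Sum using (_⊎_; inj₁; inj₂)
open import Data.Empty using (⊥-elim)
open import Function using (_∘_)
open import Relation.Nullary using (yes; no)
open import Relation.Binary.PropositionalEquality
  using (_≡_; refl; sym; trans; cong; cong₂; subst; module ≡-Reasoning)
open import Data.List using (List; []; _∷_; _++_; length; applyUpTo; concatMap; map; upTo)
open import Data.List.Properties using (length-++; length-applyUpTo; length-map)
open import Data.List.Membership.Propositional using (_∈_)
open import Data.List.Membership.Propositional.Properties
  using ( ∈-applyUpTo⁺; ∈-∃++; ∈-++⁻; ∈-++⁺ˡ; ∈-++⁺ʳ; ∈-deduplicate⁺; ∈-deduplicate⁻; ∈-map⁺; ∈-map⁻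
        ; ∈-upTo⁺; ∈-upTo⁻; ∈-cartesianProductWith⁺; ∈-cartesianProductWith⁻)
open import Data.List.Relation.Unary.Any using (here; there)
open import Data.List.Relation.Unary.All as All using (All)
import Data.List.Relation.Unary.All.Properties as All
open import Data.List.Relation.Unary.Linked using (Linked)
open import Data.List.Relation.Unary.Unique.Propositional using (Unique)
import Data.List.Relation.Unary.Unique.Propositional.Properties as Unique
open import Data.List.Relation.Unary.Unique.DecPropositional.Properties using (deduplicate-!)

-- Counting by enumeration

-- The constructors of All, AllPairs and Linked are opened only in such local modules, since the
-- ring solver needs an unambiguous _∷_ for its lists of variables.
module _ where
  open import Data.List.Relation.Unary.All using ([]; _∷_)
  open import Data.List.Relation.Unary.AllPairs using ([]; _∷_)
  open import Data.List.Relation.Unary.Linked using ([]; [-]; _∷_)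

  unique-⊆⇒length≤ : ∀ {A : Set} {xs ys : List A} → Unique xs → (∀ {x} → x ∈ xs → x ∈ ys) → length xs ≤ length ys
  unique-⊆⇒length≤ {xs = []} _ _ = z≤n
  unique-⊆⇒length≤ {xs = x ∷ xs} (x∉xs ∷ xs!) xs⊆ys with ys₁ , ys₂ , refl ← ∈-∃++ (xs⊆ys (here refl)) = begin
    suc (length xs)                ≤⟨ s≤s (unique-⊆⇒length≤ xs! xs⊆ys₁++ys₂) ⟩
    suc (length (ys₁ ++ ys₂))      ≡⟨ cong suc (length-++ ys₁) ⟩
    suc (length ys₁ + length ys₂)  ≡⟨ +-suc (length ys₁) (length ys₂) ⟨
    length ys₁ + length (x ∷ ys₂)  ≡⟨ length-++ ys₁ ⟨
    length (ys₁ ++ x ∷ ys₂)        ∎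
    where
    open ≤-Reasoning
    xs⊆ys₁++ys₂ : ∀ {y} → y ∈ xs → y ∈ ys₁ ++ ys₂
    xs⊆ys₁++ys₂ y∈xs with ∈-++⁻ ys₁ (xs⊆ys (there y∈xs))
    ... | inj₁ y∈ys₁         = ∈-++⁺ˡ y∈ys₁
    ... | inj₂ (here refl)   = ⊥-elim (All.lookup x∉xs y∈xs refl)
    ... | inj₂ (there y∈ys₂) = ∈-++⁺ʳ ys₁ y∈ys₂

  card≡length : ∀ {xs} ys → Unique ys → (∀ {x} → x ∈ xs → x ∈ ys) → (∀ {x} → x ∈ ys → x ∈ xs) → card xs ≡ length ys
  card≡length {xs} ys ys! xs⊆ys ys⊆xs = ≤-antisym
    (unique-⊆⇒length≤ (deduplicate-! ℤ._≟_ xs) (xs⊆ys ∘ ∈-deduplicate⁻ ℤ._≟_ xs))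
    (unique-⊆⇒length≤ ys! (∈-deduplicate⁺ ℤ._≟_ ∘ ys⊆xs))

  -- Concatenations of separated arithmetic progressions

  record Block : Set where
    constructor block
    field
      first step count : ℕ

  open Block public

  elements : Block → List ℕ
  elements (block a s k) = applyUpTo (λ j → a + j * s) k

  ∈-elements⁺ : ∀ {a s k} j → j < k → a + j * s ∈ elements (block a s k)
  ∈-elements⁺ _ = ∈-applyUpTo⁺ _

  ∈-interval⁺ : ∀ {a k} j → j < k → a + j ∈ elements (block a 1 k)
  ∈-interval⁺ {a} {k} j j<k = subst (_∈ elements (block a 1 k)) (cong (a +_) (*-identityʳ j)) (∈-elements⁺ j j<k)

  elements-All : ∀ {P : ℕ → Set} {a s k} → (∀ {j} → j < k → P (a + j * s)) → All P (elements (block a s k))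
  elements-All {k = k} = All.applyUpTo⁺₁ _ k

  elements-unique : ∀ a s k .{{_ : NonZero s}} → Unique (elements (block a s k))
  elements-unique a s k = Unique.applyUpTo⁺₁ _ k (λ i<j _ → <⇒≢ (+-monoʳ-< a (*-monoˡ-< s i<j)))

  elements-≥ : ∀ b → All (first b ≤_) (elements b)
  elements-≥ (block a s k) = All.applyUpTo⁺₂ _ k (λ j → m≤m+n a (j * s))

  record _≺_ (b b′ : Block) : Set where
    constructor precedes
    field
      first≤first : first b ≤ first b′
      elements<   : All (_< first b′) (elements b)

  concatBlocks : List Block → List ℕ
  concatBlocks = concatMap elements

  concatBlocks-≥ : ∀ {b bs} → Linked _≺_ (b ∷ bs) → All (first b ≤_) (concatBlocks (b ∷ bs))
  concatBlocks-≥ {b} [-]                = All.++⁺ (elements-≥ b) []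
  concatBlocks-≥ {b} (precedes b≤b′ _ ∷ bs≺) = All.++⁺ (elements-≥ b) (All.map (≤-trans b≤b′) (concatBlocks-≥ bs≺))

  concatBlocks-unique : ∀ {bs} → All (NonZero ∘ step) bs → Linked _≺_ bs → Unique (concatBlocks bs)
  concatBlocks-unique [] [] = []
  concatBlocks-unique {block a s k ∷ _} (s≢0 ∷ []) [-] =
    Unique.++⁺ (elements-unique a s k {{s≢0}}) [] λ ()
  concatBlocks-unique {block a s k ∷ _} (s≢0 ∷ steps≢0) (precedes _ below ∷ bs≺) =
    Unique.++⁺ (elements-unique a s k {{s≢0}}) (concatBlocks-unique steps≢0 bs≺)
      λ (x∈b , x∈bs) → <⇒≱ (All.lookup below x∈b) (All.lookup (concatBlocks-≥ bs≺) x∈bs)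

  length-concatBlocks : ∀ bs → length (concatBlocks bs) ≡ sum (map count bs)
  length-concatBlocks [] = refl
  length-concatBlocks (b@(block a s k) ∷ bs) =
    trans (length-++ (elements b)) (cong₂ _+_ (length-applyUpTo _ k) (length-concatBlocks bs))

  ∈-concatBlocks : ∀ {x b bs} → b ∈ bs → x ∈ elements b → x ∈ concatBlocks bs
  ∈-concatBlocks (here refl)         x∈b = ∈-++⁺ˡ x∈b
  ∈-concatBlocks {bs = b ∷ _} (there b′∈bs) x∈b′ = ∈-++⁺ʳ (elements b) (∈-concatBlocks b′∈bs x∈b′)

  concatBlocks-All : ∀ {P : ℕ → Set} {bs} → All (All P ∘ elements) bs → All P (concatBlocks bs)
  concatBlocks-All = All.concat⁺ ∘ All.map⁺

  ≺-intro : ∀ {a s k b′} → 0 < k → a + k * s < first b′ + s → block a s k ≺ b′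
  ≺-intro {a} {s} {k} {b′} 0<k next<a′+s = precedes (≤-trans (m≤m+n a (0 * s)) (<⇒≤ (below 0<k))) (elements-All below)
    where
    open ≤-Reasoning
    below : ∀ {j} → j < k → a + j * s < first b′
    below {j} j<k = +-cancelʳ-< s _ _ (begin-strict
      a + j * s + s    ≡⟨ trans (+-assoc a (j * s) s) (cong (a +_) (+-comm (j * s) s)) ⟩
      a + suc j * s    ≤⟨ +-monoʳ-≤ a (*-monoˡ-≤ s j<k) ⟩
      a + k * s        <⟨ next<a′+s ⟩
      first b′ + s     ∎)

split-≤-+ : ∀ m {n s} → s ≤ m + n → ∃₂ λ i j → i ≤ m × j ≤ n × s ≡ i + j
split-≤-+ m {s = s} s≤m+n with s ≤? m
... | yes s≤m = s , 0 , s≤m , z≤n , sym (+-identityʳ s)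
... | no  s≰m with j , refl ← m≤n⇒∃[o]m+o≡n (<⇒≤ (≰⇒> s≰m)) = m , j , ≤-refl , +-cancelˡ-≤ m _ _ s≤m+n , refl

split-≤-*+ : ∀ n d k → k ≤ n * d + d → ∃₂ λ i t → i ≤ n × t ≤ d × k ≡ i * d + t
split-≤-*+ zero    d k k≤d = 0 , k , z≤n , k≤d , refl
split-≤-*+ (suc n) d k k≤  with k ≤? d
... | yes k≤d = 0 , k , z≤n , k≤d , refl
... | no  k≰d
  with k′ , refl ← m≤n⇒∃[o]m+o≡n (<⇒≤ (≰⇒> k≰d))
  with i , t , i≤n , t≤d , refl ← split-≤-*+ n d k′ (+-cancelˡ-≤ d _ _ (subst (d + k′ ≤_) (+-assoc d (n * d) d) k≤))
  = suc i , t , s≤s i≤n , t≤d , sym (+-assoc d (i * d) t)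

+-≤-double : ∀ {i j n} → i ≤ n → j ≤ n → i + j ≤ 2 * n
+-≤-double {n = n} i≤n j≤n = +-mono-≤ i≤n (subst (_ ≤_) (sym (+-identityʳ n)) j≤n)

≤+⇒≤⊎≡suc : ∀ {k b v} → v ≤ 1 → k ≤ b + v → k ≤ b ⊎ k ≡ suc b
≤+⇒≤⊎≡suc {k} {b} {v} v≤1 k≤b+v with m≤n⇒m<n∨m≡n (≤-trans k≤b+v (subst (b + v ≤_) (+-comm b 1) (+-monoʳ-≤ b v≤1)))
... | inj₁ k<1+b = inj₁ (≤-pred k<1+b)
... | inj₂ k≡1+b = inj₂ k≡1+b

+[m+n]-+n≡+m : ∀ m n → ℤ.+ (m + n) - ℤ.+ n ≡ ℤ.+ m
+[m+n]-+n≡+m m n = begin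
  ℤ.+ (m + n) - ℤ.+ n              ≡⟨ cong (_- ℤ.+ n) (ℤ.pos-+ m n) ⟩
  (ℤ.+ m) ℤ.+ (ℤ.+ n) - ℤ.+ n      ≡⟨ ℤ.+-assoc (ℤ.+ m) (ℤ.+ n) (- ℤ.+ n) ⟩
  (ℤ.+ m) ℤ.+ ((ℤ.+ n) - ℤ.+ n)    ≡⟨ cong (ℤ._+_ (ℤ.+ m)) (ℤ.+-inverseʳ (ℤ.+ n)) ⟩
  (ℤ.+ m) ℤ.+ ℤ.+ 0                ≡⟨ ℤ.+-identityʳ (ℤ.+ m) ⟩
  ℤ.+ m                            ∎
  where open ≡-Reasoning

+α-+β≡+[α+γ]-+[β+γ] : ∀ α β γ → ℤ.+ α - ℤ.+ β ≡ ℤ.+ (α + γ) - ℤ.+ (β + γ)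
+α-+β≡+[α+γ]-+[β+γ] α β γ = begin
  ℤ.+ α - ℤ.+ β                                  ≡⟨ shift (ℤ.+ α) (ℤ.+ β) (ℤ.+ γ) ⟩
  (ℤ.+ α) ℤ.+ (ℤ.+ γ) - ((ℤ.+ β) ℤ.+ (ℤ.+ γ))    ≡⟨ cong₂ _-_ (ℤ.pos-+ α γ) (ℤ.pos-+ β γ) ⟨
  ℤ.+ (α + γ) - ℤ.+ (β + γ)                      ∎
  where
  open ≡-Reasoning
  shift : ∀ a b c → a - b ≡ a ℤ.+ c - (b ℤ.+ c)
  shift = ℤSolver.solve-∀

+s-+m-injective : ∀ m {s t} → ℤ.+ s - ℤ.+ m ≡ ℤ.+ t - ℤ.+ m → s ≡ t
+s-+m-injective m {s} {t} eq = ℤ.+-injective (begin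
  ℤ.+ s                          ≡⟨ cancel (ℤ.+ s) (ℤ.+ m) ⟩
  (ℤ.+ s - ℤ.+ m) ℤ.+ (ℤ.+ m)    ≡⟨ cong (ℤ._+ ℤ.+ m) eq ⟩
  (ℤ.+ t - ℤ.+ m) ℤ.+ (ℤ.+ m)    ≡⟨ cancel (ℤ.+ t) (ℤ.+ m) ⟨
  ℤ.+ t                          ∎)
  where
  open ≡-Reasoning
  cancel : ∀ a b → a ≡ a - b ℤ.+ b
  cancel = ℤSolver.solve-∀

-- The sets A and m − A

-- InA n d v α says α ∈ Aᵥ; A₀ is A and A₁ is m − A (see reflect).  Y is listed upwards from C.
data InA (n d v : ℕ) : ℕ → Set where
  inX      : ∀ {j} → j ≤ n → InA n d v (j * d)
  inMiddle : ∀ {t} → t ≤ d → InA n d v (2 * n * d + (v + t))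
  inY      : ∀ {j} → j ≤ n → InA n d v (3 * (n * d) + d + 1 + j * d)

reflect : ∀ {n d v w α} → v + w ≡ 1 → InA n d v α → ∃ λ β → InA n d w β × α + β ≡ (4 * n + 1) * d + 1
reflect {d = d} _ (inX {j} j≤n) with k , refl ← m≤n⇒∃[o]m+o≡n j≤n =
  3 * ((j + k) * d) + d + 1 + k * d , inY (m≤n+m k j) , solve (j ∷ k ∷ d ∷ [])
reflect {d = d} _ (inY {j} j≤n) with k , refl ← m≤n⇒∃[o]m+o≡n j≤n =
  k * d , inX (m≤n+m k j) , solve (j ∷ k ∷ d ∷ [])
reflect {n} {v = v} {w} v+w≡1 (inMiddle {t} t≤d) with r , refl ← m≤n⇒∃[o]m+o≡n t≤d =
  2 * n * (t + r) + (w + r) , inMiddle (m≤n+m r t) ,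
  (begin
    2 * n * (t + r) + (v + t) + (2 * n * (t + r) + (w + r))  ≡⟨ solve (n ∷ v ∷ w ∷ t ∷ r ∷ []) ⟩
    (4 * n + 1) * (t + r) + (v + w)                          ≡⟨ cong ((4 * n + 1) * (t + r) +_) v+w≡1 ⟩
    (4 * n + 1) * (t + r) + 1                                ∎)
  where open ≡-Reasoning

∈X⇒InA : ∀ {n d x} → x ∈ X n d → ∃ λ α → x ≡ ℤ.+ α × InA n d 0 α
∈X⇒InA {n} {d} x∈X with j , j∈ , refl ← ∈-map⁻ (λ i → ℤ.+ (i * d)) {xs = upTo (suc n)} x∈X =
  j * d , refl , inX (≤-pred (∈-upTo⁻ j∈))

∈Y⇒InA : ∀ {n d x} → x ∈ Y n d → ∃ λ α → x ≡ ℤ.+ α × InA n d 0 α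
∈Y⇒InA {n} {d} x∈Y with y , y∈X , refl ← ∈-map⁻ (λ y → mval n d - y) {xs = X n d} x∈Y
  with j , j∈ , refl ← ∈-map⁻ (λ i → ℤ.+ (i * d)) {xs = upTo (suc n)} y∈X
  with k , refl ← m≤n⇒∃[o]m+o≡n (≤-pred (∈-upTo⁻ j∈)) =
  3 * ((j + k) * d) + d + 1 + k * d , mirror , inY (m≤n+m k j)
  where
  top≡ : (4 * (j + k) + 1) * d + 1 ≡ 3 * ((j + k) * d) + d + 1 + k * d + j * d
  top≡ = solve (j ∷ k ∷ d ∷ [])
  mirror : mval (j + k) d - ℤ.+ (j * d) ≡ ℤ.+ (3 * ((j + k) * d) + d + 1 + k * d)
  mirror = trans (cong (λ z → ℤ.+ z - ℤ.+ (j * d)) top≡) (+[m+n]-+n≡+m _ (j * d))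

∈Aset⇒InA : ∀ {n d x} → x ∈ Aset n d → ∃ λ α → x ≡ ℤ.+ α × InA n d 0 α
∈Aset⇒InA {n} {d} x∈A with ∈-++⁻ (B n d) x∈A
... | inj₂ (here refl) = 2 * n * d + (0 + 0) , cong ℤ.+_ (sym (+-identityʳ _)) , inMiddle z≤n
... | inj₁ x∈B with ∈-++⁻ (X n d) x∈B
...   | inj₁ x∈X = ∈X⇒InA x∈X
...   | inj₂ x∈YZ with ∈-++⁻ (Y n d) x∈YZ
...     | inj₁ x∈Y = ∈Y⇒InA x∈Y
...     | inj₂ x∈Z with k , k∈ , refl ← ∈-map⁻ (λ i → ℤ.+ (2 * n * d + suc i)) {xs = upTo d} x∈Z =
  2 * n * d + (0 + suc k) , refl , inMiddle (∈-upTo⁻ k∈)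

InA⇒∈Aset : ∀ {n d α} → InA n d 0 α → ℤ.+ α ∈ Aset n d
InA⇒∈Aset {n} {d} (inX {j} j≤n) = ∈-++⁺ˡ (∈-++⁺ˡ (∈-map⁺ (λ i → ℤ.+ (i * d)) (∈-upTo⁺ (s≤s j≤n))))
InA⇒∈Aset {n} {d} (inMiddle {zero} _) =
  ∈-++⁺ʳ (B n d) (here (cong ℤ.+_ (+-identityʳ _)))
InA⇒∈Aset {n} {d} (inMiddle {suc k} k<d) =
  ∈-++⁺ˡ (∈-++⁺ʳ (X n d) (∈-++⁺ʳ (Y n d) (∈-map⁺ (λ i → ℤ.+ (2 * n * d + suc i)) (∈-upTo⁺ k<d))))
InA⇒∈Aset {d = d} (inY {j} j≤n) with k , refl ← m≤n⇒∃[o]m+o≡n j≤n =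
  ∈-++⁺ˡ (∈-++⁺ʳ (X (j + k) d) (∈-++⁺ˡ (subst (_∈ Y (j + k) d) mirror
    (∈-map⁺ (λ x → mval (j + k) d - x) (∈-map⁺ (λ i → ℤ.+ (i * d)) (∈-upTo⁺ (s≤s (m≤n+m k j))))))))
  where
  top≡ : (4 * (j + k) + 1) * d + 1 ≡ 3 * ((j + k) * d) + d + 1 + j * d + k * d
  top≡ = solve (j ∷ k ∷ d ∷ [])
  mirror : mval (j + k) d - ℤ.+ (k * d) ≡ ℤ.+ (3 * ((j + k) * d) + d + 1 + j * d)
  mirror = trans (cong (λ z → ℤ.+ z - ℤ.+ (k * d)) top≡) (+[m+n]-+n≡+m _ (k * d))

-- The sumsets A + A and A + (m − A)

sumBlocks : ℕ → ℕ → ℕ → List Block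
sumBlocks n d v =
  block 0                               d (2 * n)              ∷
  block (2 * (n * d))                   1 (suc (n * d + d))    ∷
  block (3 * (n * d) + d + 1)           d (n ∸ 1)              ∷
  block (4 * (n * d) + v)               1 (suc (2 * d) ∸ v)    ∷
  block (4 * (n * d) + 2 * d + 1)       d (n ∸ 1)              ∷
  block (5 * (n * d) + d + 1)           1 (suc (n * d + d))    ∷
  block (6 * (n * d) + 2 * d + 2)       d (suc (2 * n))        ∷ []

-- Each block is named after the parts of A whose sums it mainly collects (M is the middle interval).
pattern X+X = here refl
pattern X+M = there X+X
pattern X+Y₁ = there X+M
pattern M+M = there X+Y₁
pattern X+Y₂ = there M+M
pattern M+Y = there X+Y₂
pattern Y+Y = there M+Y

sums : ℕ → ℕ → ℕ → List ℕ
sums n d v = concatBlocks (sumBlocks n d v)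

IsSum : ℕ → ℕ → ℕ → ℕ → Set
IsSum n d v x = ∃₂ λ α β → InA n d 0 α × InA n d v β × x ≡ α + β

module _ {n d v : ℕ} (1<n : 1 < n) (1<d : 1 < d) (v≤1 : v ≤ 1) where

  open ≤-Reasoning

  ∈-sums : ∀ {x b} → b ∈ sumBlocks n d v → x ∈ elements b → x ∈ sums n d v
  ∈-sums = ∈-concatBlocks

  multiple∈sums : ∀ s → s ≤ 2 * n → s * d ∈ sums n d v
  multiple∈sums s s≤2n with m≤n⇒m<n∨m≡n s≤2n
  ... | inj₁ s<2n = ∈-sums X+X (∈-elements⁺ s s<2n)
  ... | inj₂ refl = subst (_∈ sums n d v) (trans (+-identityʳ _) (sym (*-assoc 2 n d)))
                      (∈-sums X+M (∈-interval⁺ 0 z<s))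

  lower∈sums : ∀ k → k ≤ n * d + d → 2 * (n * d) + k ∈ sums n d v
  lower∈sums k k≤ = ∈-sums X+M (∈-interval⁺ k (s≤s k≤))

  middle∈sums : ∀ x → v ≤ x → x ≤ 2 * d → 4 * (n * d) + x ∈ sums n d v
  middle∈sums x v≤x x≤2d with k , refl ← m≤n⇒∃[o]m+o≡n v≤x =
    subst (_∈ sums n d v) (+-assoc (4 * (n * d)) v k)
      (∈-sums M+M (∈-interval⁺ k (m+n≤o⇒m≤o∸n (suc k) (s≤s (subst (_≤ 2 * d) (+-comm v k) x≤2d)))))

  upper∈sums : ∀ k → k ≤ n * d + d → 5 * (n * d) + d + 1 + k ∈ sums n d v
  upper∈sums k k≤ = ∈-sums M+Y (∈-interval⁺ k (s≤s k≤))

  2C+multiple∈sums : ∀ s → s ≤ 2 * n → 6 * (n * d) + 2 * d + 2 + s * d ∈ sums n d v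
  2C+multiple∈sums s s≤2n = ∈-sums Y+Y (∈-elements⁺ s (s≤s s≤2n))

  1≤2d : 1 ≤ 2 * d
  1≤2d = ≤-trans (<⇒≤ 1<d) (m≤m+n d (d + 0))

  d+1≤2d : d + 1 ≤ 2 * d
  d+1≤2d = +-monoʳ-≤ d (subst (1 ≤_) (sym (+-identityʳ d)) (<⇒≤ 1<d))

  -- C + sd lies in X+Y₁ for s ≤ n − 2, in M+M for s ∈ {n − 1, n}, in X+Y₂ for n < s < 2n,
  -- and in M+Y for s = 2n.
  C+multiple∈sums : ∀ s → s ≤ 2 * n → 3 * (n * d) + d + 1 + s * d ∈ sums n d v
  C+multiple∈sums s s≤2n with p , refl ← m≤n⇒∃[o]m+o≡n 1<n with m≤n⇒m<n∨m≡n s≤2n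
  ... | inj₂ refl = subst (_∈ sums (2 + p) d v) (begin-equality
          5 * ((2 + p) * d) + d + 1 + 0            ≡⟨ solve (p ∷ d ∷ []) ⟩
          3 * ((2 + p) * d) + d + 1 + 2 * (2 + p) * d  ∎) (upper∈sums 0 z≤n)
  ... | inj₁ s<2n with s ≤? p
  ...   | yes s≤p = ∈-sums X+Y₁ (∈-elements⁺ s (s≤s s≤p))
  ...   | no  s≰p with e , refl ← m≤n⇒∃[o]m+o≡n (≰⇒> s≰p) with e
  ...     | 0 = subst (_∈ sums (2 + p) d v) (begin-equality
              4 * ((2 + p) * d) + 1                        ≡⟨ solve (p ∷ d ∷ []) ⟩
              3 * ((2 + p) * d) + d + 1 + (suc p + 0) * d  ∎) (middle∈sums 1 v≤1 1≤2d)
  ...     | 1 = subst (_∈ sums (2 + p) d v) (begin-equality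
              4 * ((2 + p) * d) + (d + 1)                  ≡⟨ solve (p ∷ d ∷ []) ⟩
              3 * ((2 + p) * d) + d + 1 + (suc p + 1) * d  ∎) (middle∈sums (d + 1) (≤-trans v≤1 (m≤n+m 1 d)) d+1≤2d)
  ...     | suc (suc r) = subst (_∈ sums (2 + p) d v) (begin-equality
              4 * ((2 + p) * d) + 2 * d + 1 + r * d                ≡⟨ solve (p ∷ d ∷ r ∷ []) ⟩
              3 * ((2 + p) * d) + d + 1 + (suc p + (2 + r)) * d    ∎) (∈-sums X+Y₂ (∈-elements⁺ r r<1+p))
    where
    r<1+p : r < suc p
    r<1+p = +-cancelˡ-≤ (3 + p) (suc r) (suc p) (begin
      3 + p + suc r            ≡⟨ solve (p ∷ r ∷ []) ⟩
      suc (suc p + (2 + r))    ≤⟨ s<2n ⟩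
      2 * (2 + p)              ≡⟨ solve (p ∷ []) ⟩
      3 + p + suc p            ∎)

  n+1≤2n : n + 1 ≤ 2 * n
  n+1≤2n = +-monoʳ-≤ n (subst (1 ≤_) (sym (+-identityʳ n)) (<⇒≤ 1<n))

  -- For v = 1 the sums in X + M, M + M and M + Y overshoot their block by exactly one element,
  -- namely C, C + (n + 1)d and 2C.
  lower⁺∈sums : ∀ k → k ≤ n * d + d + v → 2 * (n * d) + k ∈ sums n d v
  lower⁺∈sums k k≤ with ≤+⇒≤⊎≡suc v≤1 k≤
  ... | inj₁ k≤′ = lower∈sums k k≤′
  ... | inj₂ refl = subst (_∈ sums n d v) (begin-equality
          3 * (n * d) + d + 1 + 0 * d    ≡⟨ solve (n ∷ d ∷ []) ⟩
          2 * (n * d) + suc (n * d + d)  ∎) (C+multiple∈sums 0 z≤n)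

  middle⁺∈sums : ∀ x → v ≤ x → x ≤ 2 * d + v → 4 * (n * d) + x ∈ sums n d v
  middle⁺∈sums x v≤x x≤ with ≤+⇒≤⊎≡suc v≤1 x≤
  ... | inj₁ x≤2d = middle∈sums x v≤x x≤2d
  ... | inj₂ refl = subst (_∈ sums n d v) (begin-equality
          3 * (n * d) + d + 1 + (n + 1) * d  ≡⟨ solve (n ∷ d ∷ []) ⟩
          4 * (n * d) + suc (2 * d)          ∎) (C+multiple∈sums (n + 1) n+1≤2n)

  upper⁺∈sums : ∀ k → k ≤ n * d + d + v → 5 * (n * d) + d + 1 + k ∈ sums n d v
  upper⁺∈sums k k≤ with ≤+⇒≤⊎≡suc v≤1 k≤
  ... | inj₁ k≤′ = upper∈sums k k≤′
  ... | inj₂ refl = subst (_∈ sums n d v) (begin-equality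
          6 * (n * d) + 2 * d + 2 + 0 * d            ≡⟨ solve (n ∷ d ∷ []) ⟩
          5 * (n * d) + d + 1 + suc (n * d + d)      ∎) (2C+multiple∈sums 0 z≤n)

  sum∈sums : ∀ {α β} → InA n d 0 α → InA n d v β → α + β ∈ sums n d v
  sum∈sums (inX {i} i≤n) (inX {j} j≤n) =
    subst (_∈ sums n d v) (*-distribʳ-+ d i j) (multiple∈sums (i + j) (+-≤-double i≤n j≤n))
  sum∈sums (inX {i} i≤n) (inMiddle {t} t≤d) = subst (_∈ sums n d v) (begin-equality
    2 * (n * d) + (i * d + t + v)       ≡⟨ solve (n ∷ d ∷ i ∷ t ∷ v ∷ []) ⟩
    i * d + (2 * n * d + (v + t))       ∎) (lower⁺∈sums _ (+-monoˡ-≤ v (+-mono-≤ (*-monoˡ-≤ d i≤n) t≤d)))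
  sum∈sums (inX {i} i≤n) (inY {j} j≤n) = subst (_∈ sums n d v) (begin-equality
    3 * (n * d) + d + 1 + (i + j) * d   ≡⟨ solve (n ∷ d ∷ i ∷ j ∷ []) ⟩
    i * d + (3 * (n * d) + d + 1 + j * d)  ∎) (C+multiple∈sums (i + j) (+-≤-double i≤n j≤n))
  sum∈sums (inMiddle {t} t≤d) (inX {j} j≤n) = subst (_∈ sums n d v) (begin-equality
    2 * (n * d) + (j * d + t)           ≡⟨ solve (n ∷ d ∷ j ∷ t ∷ []) ⟩
    2 * n * d + (0 + t) + j * d         ∎) (lower⁺∈sums _ (≤-trans (+-mono-≤ (*-monoˡ-≤ d j≤n) t≤d) (m≤m+n _ v)))
  sum∈sums (inMiddle {t} t≤d) (inMiddle {u} u≤d) = subst (_∈ sums n d v) (begin-equality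
    4 * (n * d) + (t + u + v)                  ≡⟨ solve (n ∷ d ∷ t ∷ u ∷ v ∷ []) ⟩
    2 * n * d + (0 + t) + (2 * n * d + (v + u))  ∎) (middle⁺∈sums _ (m≤n+m v (t + u)) (+-monoˡ-≤ v (+-≤-double t≤d u≤d)))
  sum∈sums (inMiddle {t} t≤d) (inY {j} j≤n) = subst (_∈ sums n d v) (begin-equality
    5 * (n * d) + d + 1 + (j * d + t)             ≡⟨ solve (n ∷ d ∷ j ∷ t ∷ []) ⟩
    2 * n * d + (0 + t) + (3 * (n * d) + d + 1 + j * d)  ∎) (upper⁺∈sums _ (≤-trans (+-mono-≤ (*-monoˡ-≤ d j≤n) t≤d) (m≤m+n _ v)))
  sum∈sums (inY {j} j≤n) (inX {i} i≤n) = subst (_∈ sums n d v) (begin-equality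
    3 * (n * d) + d + 1 + (j + i) * d   ≡⟨ solve (n ∷ d ∷ i ∷ j ∷ []) ⟩
    3 * (n * d) + d + 1 + j * d + i * d  ∎) (C+multiple∈sums (j + i) (+-≤-double j≤n i≤n))
  sum∈sums (inY {j} j≤n) (inMiddle {t} t≤d) = subst (_∈ sums n d v) (begin-equality
    5 * (n * d) + d + 1 + (j * d + t + v)  ≡⟨ solve (n ∷ d ∷ j ∷ t ∷ v ∷ []) ⟩
    3 * (n * d) + d + 1 + j * d + (2 * n * d + (v + t))  ∎) (upper⁺∈sums _ (+-monoˡ-≤ v (+-mono-≤ (*-monoˡ-≤ d j≤n) t≤d)))
  sum∈sums (inY {i} i≤n) (inY {j} j≤n) = subst (_∈ sums n d v) (begin-equality
    6 * (n * d) + 2 * d + 2 + (i + j) * d  ≡⟨ solve (n ∷ d ∷ i ∷ j ∷ []) ⟩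
    3 * (n * d) + d + 1 + i * d + (3 * (n * d) + d + 1 + j * d)  ∎) (2C+multiple∈sums (i + j) (+-≤-double i≤n j≤n))

  2n≡n+n : 2 * n ≡ n + n
  2n≡n+n = cong (n +_) (+-identityʳ n)

  isSum-X+X : ∀ {j} → j < 2 * n → IsSum n d v (0 + j * d)
  isSum-X+X {j} j<2n with i , k , i≤n , k≤n , refl ← split-≤-+ n (subst (j ≤_) 2n≡n+n (<⇒≤ j<2n)) =
    i * d , k * d , inX i≤n , inX k≤n , *-distribʳ-+ d i k

  isSum-X+M : ∀ {k} → k < suc (n * d + d) → IsSum n d v (2 * (n * d) + k * 1)
  isSum-X+M {k} (s≤s k≤) with i , t , i≤n , t≤d , refl ← split-≤-*+ n d k k≤ =
    2 * n * d + (0 + t) , i * d , inMiddle t≤d , inX i≤n , solve (n ∷ d ∷ i ∷ t ∷ [])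

  isSum-X+Y₁ : ∀ {j} → j < n ∸ 1 → IsSum n d v (3 * (n * d) + d + 1 + j * d)
  isSum-X+Y₁ {j} j<n-1 =
    j * d , 3 * (n * d) + d + 1 + 0 * d , inX (≤-trans (<⇒≤ j<n-1) (m∸n≤m n 1)) , inY z≤n ,
    solve (n ∷ d ∷ j ∷ [])

  isSum-M+M : ∀ {k} → k < suc (2 * d) ∸ v → IsSum n d v (4 * (n * d) + v + k * 1)
  isSum-M+M {k} k< with t , u , t≤d , u≤d , refl ← split-≤-+ d (subst (k ≤_) (cong (d +_) (+-identityʳ d)) (≤-pred (≤-trans k< (m∸n≤m _ v)))) =
    2 * n * d + (0 + t) , 2 * n * d + (v + u) , inMiddle t≤d , inMiddle u≤d , solve (n ∷ d ∷ v ∷ t ∷ u ∷ [])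

  isSum-X+Y₂ : ∀ {j} → j < n ∸ 1 → IsSum n d v (4 * (n * d) + 2 * d + 1 + j * d)
  isSum-X+Y₂ {j} j<n-1 =
    n * d , 3 * (n * d) + d + 1 + suc j * d , inX ≤-refl , inY (≤-trans j<n-1 (m∸n≤m n 1)) ,
    solve (n ∷ d ∷ j ∷ [])

  isSum-M+Y : ∀ {k} → k < suc (n * d + d) → IsSum n d v (5 * (n * d) + d + 1 + k * 1)
  isSum-M+Y {k} (s≤s k≤) with i , t , i≤n , t≤d , refl ← split-≤-*+ n d k k≤ =
    2 * n * d + (0 + t) , 3 * (n * d) + d + 1 + i * d , inMiddle t≤d , inY i≤n , solve (n ∷ d ∷ i ∷ t ∷ [])

  isSum-Y+Y : ∀ {s} → s < suc (2 * n) → IsSum n d v (6 * (n * d) + 2 * d + 2 + s * d)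
  isSum-Y+Y {s} (s≤s s≤2n) with i , j , i≤n , j≤n , refl ← split-≤-+ n (subst (s ≤_) 2n≡n+n s≤2n) =
    3 * (n * d) + d + 1 + i * d , 3 * (n * d) + d + 1 + j * d , inY i≤n , inY j≤n , solve (n ∷ d ∷ i ∷ j ∷ [])

  0<d : 0 < d
  0<d = <-trans z<s 1<d

  X+X-below : 0 + 2 * n * d < 2 * (n * d) + d
  X+X-below = begin-strict
    0 + 2 * n * d          ≡⟨ solve (n ∷ d ∷ []) ⟩
    2 * (n * d) + 0        <⟨ +-monoʳ-< (2 * (n * d)) 0<d ⟩
    2 * (n * d) + d        ∎

  X+M-below : 2 * (n * d) + suc (n * d + d) * 1 < 3 * (n * d) + d + 1 + 1
  X+M-below = begin-strict
    2 * (n * d) + suc (n * d + d) * 1  ≡⟨ solve (n ∷ d ∷ []) ⟩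
    3 * (n * d) + d + 1 + 0            <⟨ +-monoʳ-< (3 * (n * d) + d + 1) z<s ⟩
    3 * (n * d) + d + 1 + 1            ∎

  X+Y₁-below : 3 * (n * d) + d + 1 + (n ∸ 1) * d < 4 * (n * d) + v + d
  X+Y₁-below with p , refl ← m≤n⇒∃[o]m+o≡n 1<n = begin-strict
    3 * ((2 + p) * d) + d + 1 + suc p * d    ≡⟨ solve (p ∷ d ∷ []) ⟩
    4 * ((2 + p) * d) + 1                    <⟨ +-monoʳ-< (4 * ((2 + p) * d)) 1<d ⟩
    4 * ((2 + p) * d) + d                    ≤⟨ +-monoˡ-≤ d (m≤m+n _ v) ⟩
    4 * ((2 + p) * d) + v + d                ∎

  M+M-below : 4 * (n * d) + v + (suc (2 * d) ∸ v) * 1 < 4 * (n * d) + 2 * d + 1 + 1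
  M+M-below = begin-strict
    4 * (n * d) + v + (suc (2 * d) ∸ v) * 1  ≡⟨ trans (cong (4 * (n * d) + v +_) (*-identityʳ (suc (2 * d) ∸ v))) (+-assoc (4 * (n * d)) v _) ⟩
    4 * (n * d) + (v + (suc (2 * d) ∸ v))    ≡⟨ cong (4 * (n * d) +_) (m+[n∸m]≡n (≤-trans v≤1 (s≤s z≤n))) ⟩
    4 * (n * d) + suc (2 * d)                ≡⟨ solve (n ∷ d ∷ []) ⟩
    4 * (n * d) + 2 * d + 1 + 0              <⟨ +-monoʳ-< (4 * (n * d) + 2 * d + 1) z<s ⟩
    4 * (n * d) + 2 * d + 1 + 1              ∎

  X+Y₂-below : 4 * (n * d) + 2 * d + 1 + (n ∸ 1) * d < 5 * (n * d) + d + 1 + d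
  X+Y₂-below with p , refl ← m≤n⇒∃[o]m+o≡n 1<n = begin-strict
    4 * ((2 + p) * d) + 2 * d + 1 + suc p * d  ≡⟨ solve (p ∷ d ∷ []) ⟩
    5 * ((2 + p) * d) + d + 1 + 0              <⟨ +-monoʳ-< (5 * ((2 + p) * d) + d + 1) 0<d ⟩
    5 * ((2 + p) * d) + d + 1 + d              ∎

  M+Y-below : 5 * (n * d) + d + 1 + suc (n * d + d) * 1 < 6 * (n * d) + 2 * d + 2 + 1
  M+Y-below = begin-strict
    5 * (n * d) + d + 1 + suc (n * d + d) * 1  ≡⟨ solve (n ∷ d ∷ []) ⟩
    6 * (n * d) + 2 * d + 2 + 0                <⟨ +-monoʳ-< (6 * (n * d) + 2 * d + 2) z<s ⟩
    6 * (n * d) + 2 * d + 2 + 1                ∎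

  module _ where
    open import Data.List.Relation.Unary.All using ([]; _∷_)
    open import Data.List.Relation.Unary.Linked using ([-]; _∷_)

    sums-IsSum : All (IsSum n d v) (sums n d v)
    sums-IsSum = concatBlocks-All
      ( elements-All isSum-X+X ∷ elements-All isSum-X+M ∷ elements-All isSum-X+Y₁ ∷ elements-All isSum-M+M
      ∷ elements-All isSum-X+Y₂ ∷ elements-All isSum-M+Y ∷ elements-All isSum-Y+Y ∷ [])

    sums-unique : Unique (sums n d v)
    sums-unique = concatBlocks-unique {sumBlocks n d v}
      (d≢0 ∷ 1≢0 ∷ d≢0 ∷ 1≢0 ∷ d≢0 ∷ 1≢0 ∷ d≢0 ∷ [])
      ( ≺-intro (≤-trans (<⇒≤ 1<n) (m≤m+n n _)) X+X-below
      ∷ ≺-intro z<s X+M-below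
      ∷ ≺-intro (m<n⇒0<n∸m 1<n) X+Y₁-below
      ∷ ≺-intro (m<n⇒0<n∸m (s≤s (≤-trans v≤1 1≤2d))) M+M-below
      ∷ ≺-intro (m<n⇒0<n∸m 1<n) X+Y₂-below
      ∷ ≺-intro z<s M+Y-below
      ∷ [-])
      where
      d≢0 : NonZero d
      d≢0 = >-nonZero 0<d
      1≢0 : NonZero 1
      1≢0 = >-nonZero z<s

sums-length : ∀ n d → length (sums n d 0) ≡ suc (length (sums n d 1))
sums-length n d = begin
  length (sums n d 0)                       ≡⟨ length-concatBlocks (sumBlocks n d 0) ⟩
  sum (map count (sumBlocks n d 0))         ≡⟨ suc-out (2 * n) (suc (n * d + d)) (n ∸ 1) (2 * d) _ ⟩
  suc (sum (map count (sumBlocks n d 1)))   ≡⟨ cong suc (length-concatBlocks (sumBlocks n d 1)) ⟨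
  suc (length (sums n d 1))                 ∎
  where
  open ≡-Reasoning
  suc-out : ∀ a b c x r → a + (b + (c + (suc x + r))) ≡ suc (a + (b + (c + (x + r))))
  suc-out = solve-∀

module _ {n d : ℕ} (1<n : 1 < n) (1<d : 1 < d) where

  card-sumset : card (sumset (Aset n d)) ≡ length (sums n d 0)
  card-sumset = trans
    (card≡length (map ℤ.+_ (sums n d 0)) (Unique.map⁺ ℤ.+-injective (sums-unique 1<n 1<d z≤n)) A+A⊆ ⊆A+A)
    (length-map ℤ.+_ (sums n d 0))
    where
    A+A⊆ : ∀ {x} → x ∈ sumset (Aset n d) → x ∈ map ℤ.+_ (sums n d 0)
    A+A⊆ x∈ with a , b , a∈A , b∈A , refl ← ∈-cartesianProductWith⁻ ℤ._+_ (Aset n d) (Aset n d) x∈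
                with α , refl , α∈A ← ∈Aset⇒InA a∈A | β , refl , β∈A ← ∈Aset⇒InA b∈A =
      subst (_∈ map ℤ.+_ (sums n d 0)) (ℤ.pos-+ α β) (∈-map⁺ ℤ.+_ (sum∈sums 1<n 1<d z≤n α∈A β∈A))
    ⊆A+A : ∀ {x} → x ∈ map ℤ.+_ (sums n d 0) → x ∈ sumset (Aset n d)
    ⊆A+A x∈ with s , s∈ , refl ← ∈-map⁻ ℤ.+_ {xs = sums n d 0} x∈
                with α , β , α∈A , β∈A , refl ← All.lookup (sums-IsSum 1<n 1<d z≤n) s∈ =
      subst (_∈ sumset (Aset n d)) (sym (ℤ.pos-+ α β))
        (∈-cartesianProductWith⁺ ℤ._+_ (InA⇒∈Aset α∈A) (InA⇒∈Aset β∈A))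

  card-diffset : card (diffset (Aset n d)) ≡ length (sums n d 1)
  card-diffset = trans
    (card≡length (map shift (sums n d 1)) (Unique.map⁺ (+s-+m-injective top) (sums-unique 1<n 1<d ≤-refl)) A-A⊆ ⊆A-A)
    (length-map shift (sums n d 1))
    where
    top : ℕ
    top = (4 * n + 1) * d + 1
    shift : ℕ → ℤ.ℤ
    shift s = ℤ.+ s - mval n d
    A-A⊆ : ∀ {x} → x ∈ diffset (Aset n d) → x ∈ map shift (sums n d 1)
    A-A⊆ x∈ with a , b , a∈A , b∈A , refl ← ∈-cartesianProductWith⁻ _-_ (Aset n d) (Aset n d) x∈
                with α , refl , α∈A ← ∈Aset⇒InA a∈A | β , refl , β∈A ← ∈Aset⇒InA b∈A
                with β′ , β′∈A₁ , β+β′≡top ← reflect refl β∈A =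
      subst (_∈ map shift (sums n d 1))
        (trans (cong (λ m → ℤ.+ (α + β′) - ℤ.+ m) (sym β+β′≡top)) (sym (+α-+β≡+[α+γ]-+[β+γ] α β β′)))
        (∈-map⁺ shift (sum∈sums 1<n 1<d ≤-refl α∈A β′∈A₁))
    ⊆A-A : ∀ {x} → x ∈ map shift (sums n d 1) → x ∈ diffset (Aset n d)
    ⊆A-A x∈ with s , s∈ , refl ← ∈-map⁻ shift {xs = sums n d 1} x∈
                with α , β′ , α∈A , β′∈A₁ , refl ← All.lookup (sums-IsSum 1<n 1<d ≤-refl) s∈
                with β , β∈A , β′+β≡top ← reflect refl β′∈A₁ =
      subst (_∈ diffset (Aset n d))
        (trans (+α-+β≡+[α+γ]-+[β+γ] α β β′) (cong (λ m → ℤ.+ (α + β′) - ℤ.+ m) (trans (+-comm β β′) β′+β≡top)))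
        (∈-cartesianProductWith⁺ _-_ (InA⇒∈Aset α∈A) (InA⇒∈Aset β∈A))

gcdList-∣ : ∀ {x} xs → x ∈ xs → gcdList xs ℤ∣.∣ x
gcdList-∣ (y ∷ ys) (here refl)  = gcd[i,j]∣i y (gcdList ys)
gcdList-∣ (y ∷ ys) (there x∈ys) = ℕ∣.∣-trans (gcd[i,j]∣j y (gcdList ys)) (gcdList-∣ ys x∈ys)

Aset-normalised : ∀ {n d} → 0 < d → Normalised (Aset n d)
Aset-normalised {n} {d} z<s = (here refl , All.tabulate nonnegative) , gcd≡1
  where
  nonnegative : ∀ {x} → x ∈ Aset n d → ℤ.+ 0 ℤ.≤ x
  nonnegative x∈A with _ , refl , _ ← ∈Aset⇒InA x∈A = ℤ.+≤+ z≤n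
  gcd≡1 : gcdList (Aset n d) ≡ ℤ.+ 1
  gcd≡1 = cong ℤ.+_ (ℕ∣.∣1⇒≡1 (ℕ∣.∣m+n∣m⇒∣n
    (gcdList-∣ (Aset n d) (∈-++⁺ˡ (∈-++⁺ʳ (X n d) (∈-++⁺ʳ (Y n d) (here refl)))))
    (gcdList-∣ (Aset n d) (∈-++⁺ʳ (B n d) (here refl)))))

theorem4 : (n d : ℕ) → 1 < n → 1 < d →
    Normalised (Aset n d) × card (sumset (Aset n d)) ≡ card (diffset (Aset n d)) + 1
theorem4 n d 1<n 1<d = Aset-normalised (<-trans z<s 1<d) , (begin
  card (sumset (Aset n d))      ≡⟨ card-sumset 1<n 1<d ⟩
  length (sums n d 0)           ≡⟨ sums-length n d ⟩
  suc (length (sums n d 1))     ≡⟨ cong suc (card-diffset 1<n 1<d) ⟨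
  suc (card (diffset (Aset n d))) ≡⟨ +-comm 1 _ ⟩
  card (diffset (Aset n d)) + 1 ∎)
  where open ≡-Reasoning
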